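{- Let $\widetilde P_l(t):=P_l(2t-1)$ be the shifted Legendre polynomial, $P_l$ the Legendre polynomial of degree $l$. Then (1) for all $l\ge1$, $\big(t N_{G^{dual +}_{A_l}}(t)\big)' = N_{G^{dual +}_{A_l}}(t) + t N'_{G^{dual +}_{A_l}}(t) = (-1)^{l}\widetilde{P}_{l}(t)$; (2) for all $l\ge2$, $N_{G^{dual +}_{B_{l}}}(t) + \frac{t}{l}N'_{G^{dual +}_{B_{l}}}(t) = (-1)^{l}\widetilde{P}_{l}(t)$.
   Context: For a finite Coxeter type $P$ with Coxeter system $(W,S)$, set of reflections $T$, reflection length $\ell_T$, order $g\le_T h\iff \ell_T(g)+\ell_T(g^{ -1}h)=\ell_T(h)$, and bipartite Coxeter element $c$, the dual Artin monoid $G^{dual+}_P$ is the monoid generated by $T$ with relations $r\cdot s=(rsr^{ -1})\cdot r$ for all $r,s\in T$ with $rs\le_T c$; it is graded by word length $\deg$ and is a lattice for left divisibility. Its skew-growth function is $N_{G^{dual+}_P}(t)=\sum_{J\subseteq T}(-1)^{|J|}t^{\deg(\mathrm{lcm}(J))}$. It is known that $N_{G^{dual +}_{A_l}}(t)=\sum_{k=0}^{l} (-1)^{k}\frac{1}{l}\binom {l}{k}\binom {l+k}{k+1}t^k$ and $N_{G^{dual +}_{B_l}}(t)=\sum_{k=0}^{l} (-1)^{k}\binom {l}{k}\binom {l+k-1}{k}t^k$. The prime denotes $d/dt$. -}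

module Defs where

open import Data.Nat as ℕ using (ℕ; zero; suc)
open import Data.Nat.Combinatorics using (_C_)
open import Data.Integer using (+_)
open import Data.Rational using (ℚ; 0ℚ; 1ℚ; _/_; -_) renaming (_+_ to _+ℚ_; _*_ to _*ℚ_)
open import Relation.Binary.PropositionalEquality using (_≡_)
open import Data.List using (List; []; _∷_; map; upTo)

-- Polynomials with rational coefficients, as coefficient lists (constant term first).
Poly : Set
Poly = List ℚ

coeff : Poly → ℕ → ℚ
coeff []       _       = 0ℚ
coeff (a ∷ _)  zero    = a
coeff (_ ∷ p)  (suc k) = coeff p k

_≈P_ : Poly → Poly → Set
p ≈P q = ∀ k → coeff p k ≡ coeff q k
infix 4 _≈P_

ℕtoℚ : ℕ → ℚ
ℕtoℚ n = + n / 1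

-- 1/n as a rational, for n ≥ 1 (junk value 0 at n = 0, never used under the hypotheses)
inv : ℕ → ℚ
inv zero    = 0ℚ
inv (suc n) = + 1 / suc n

sgn : ℕ → ℚ
sgn zero    = 1ℚ
sgn (suc k) = - sgn k

infixl 6 _⊕_
_⊕_ : Poly → Poly → Poly
[]      ⊕ q       = q
p       ⊕ []      = p
(a ∷ p) ⊕ (b ∷ q) = (a +ℚ b) ∷ (p ⊕ q)

_·_ : ℚ → Poly → Poly
c · p = map (c *ℚ_) p
infixl 7 _·_

T : Poly
T = 0ℚ ∷ 1ℚ ∷ []

const : ℚ → Poly
const a = a ∷ []

infixl 7 _⊗_
_⊗_ : Poly → Poly → Poly
[]      ⊗ q = []
(a ∷ p) ⊗ q = (a · q) ⊕ (0ℚ ∷ (p ⊗ q))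

deriv : Poly → Poly
deriv []      = []
deriv (_ ∷ p) = go 1 p
  where
  go : ℕ → Poly → Poly
  go n []      = []
  go n (a ∷ q) = (ℕtoℚ n *ℚ a) ∷ go (suc n) q

compose : Poly → Poly → Poly
compose []      q = []
compose (a ∷ p) q = const a ⊕ (q ⊗ compose p q)

-- Legendre polynomials P_l, via Bonnet's recurrence
-- (n+2) P_{n+2}(x) = (2n+3) x P_{n+1}(x) - (n+1) P_n(x),  P_0 = 1, P_1 = x.
Legendre : ℕ → Poly
Legendre zero          = const 1ℚ
Legendre (suc zero)    = T
Legendre (suc (suc n)) =
  inv (suc (suc n)) ·
    ((ℕtoℚ (2 ℕ.* n ℕ.+ 3) · (T ⊗ Legendre (suc n)))
     ⊕ ((- ℕtoℚ (suc n)) · Legendre n))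

shiftedLegendre : ℕ → Poly
shiftedLegendre l = compose (Legendre l) (- 1ℚ ∷ ℕtoℚ 2 ∷ [])

-- Skew-growth function of the dual Artin monoid of type A_l (closed formula from the context):
--   sum_{k=0}^{l} (-1)^k (1/l) C(l,k) C(l+k,k+1) t^k
NA : ℕ → Poly
NA l = map (λ k → sgn k *ℚ (inv l *ℚ ℕtoℚ ((l C k) ℕ.* ((l ℕ.+ k) C suc k)))) (upTo (suc l))

-- Skew-growth function of the dual Artin monoid of type B_l (closed formula from the context):
--   sum_{k=0}^{l} (-1)^k C(l,k) C(l+k-1,k) t^k
NB : ℕ → Poly
NB l = map (λ k → sgn k *ℚ ℕtoℚ ((l C k) ℕ.* ((l ℕ.+ k ℕ.∸ 1) C k))) (upTo (suc l))

{-# OPTIONS --safe #-}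

-- Write L(l,k) = C(l,k)·C(l+k,k). The k-th coefficient of the shifted Legendre polynomial P̃_l is
-- (-1)^(l+k)·L(l,k): by Bonnet's recurrence this reduces to the three-term identity
--   (n+2)·L(n+2,k) + (n+1)·L(n,k) = (2n+3)·(L(n+1,k) + 2·L(n+1,k-1)),
-- which becomes Pascal's rule plus absorption once L(l,k) is rewritten as C(2k,k)·C(l+k,2k).
-- On the other side, N ↦ N + tN' and N ↦ N + (t/l)N' multiply the k-th coefficient by k+1 and
-- (l+k)/l, and the absorption identities (k+1)·C(l+k,k+1) = l·C(l+k,k) and
-- (l+k)·C(l+k-1,k) = l·C(l+k,k) turn both skew-growth coefficients into (-1)^k·L(l,k).

module Submission where

open import Defs
open import Data.Nat.Combinatorics using (_C_)
open import Data.Nat.Combinatorics.Specification using (k>n⇒nCk≡0)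
open import Data.Product using (_×_; _,_)
open import Relation.Binary.PropositionalEquality

module Binomial where

  open import Data.Nat
  open import Data.Nat.Properties
  open import Data.Nat.Combinatorics using (nC1≡n; nCk+nC[k+1]≡[n+1]C[k+1])
  open import Data.Nat.Tactic.RingSolver using (solve-∀)
  open import Algebra.Properties.CommutativeSemigroup *-commutativeSemigroup using (x∙yz≈yx∙z; x∙yz≈y∙xz)
  open import Relation.Nullary.Decidable using (yes; no)
  open ≡-Reasoning

  [k+1]*[n+1]C[k+1]≡[n+1]*nCk : ∀ n k → suc k * (suc n C suc k) ≡ suc n * (n C k)
  [k+1]*[n+1]C[k+1]≡[n+1]*nCk n zero = trans (*-identityˡ (suc n C 1)) (trans (nC1≡n (suc n)) (sym (*-identityʳ (suc n))))
  [k+1]*[n+1]C[k+1]≡[n+1]*nCk zero (suc k) = *-zeroʳ (suc (suc k))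
  [k+1]*[n+1]C[k+1]≡[n+1]*nCk (suc n) (suc k) = begin
    suc (suc k) * (suc (suc n) C suc (suc k))          ≡⟨ cong (suc (suc k) *_) (nCk+nC[k+1]≡[n+1]C[k+1] (suc n) (suc k)) ⟨
    suc (suc k) * (x + suc n C suc (suc k))            ≡⟨ *-distribˡ-+ (suc (suc k)) x _ ⟩
    x + suc k * x + suc (suc k) * (suc n C suc (suc k)) ≡⟨ cong₂ (λ u v → x + u + v) ([k+1]*[n+1]C[k+1]≡[n+1]*nCk n k) ([k+1]*[n+1]C[k+1]≡[n+1]*nCk n (suc k)) ⟩
    x + suc n * (n C k) + suc n * (n C suc k)          ≡⟨ +-assoc x _ _ ⟩
    x + (suc n * (n C k) + suc n * (n C suc k))        ≡⟨ cong (x +_) (*-distribˡ-+ (suc n) (n C k) (n C suc k)) ⟨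
    x + suc n * (n C k + n C suc k)                    ≡⟨ cong (λ u → x + suc n * u) (nCk+nC[k+1]≡[n+1]C[k+1] n k) ⟩
    suc (suc n) * x                                    ∎
    where x = suc n C suc k

  [k+1]*nC[k+1]+k*nCk≡n*nCk : ∀ n k → suc k * (n C suc k) + k * (n C k) ≡ n * (n C k)
  [k+1]*nC[k+1]+k*nCk≡n*nCk n k = +-cancelʳ-≡ x _ _ (begin
    suc k * (n C suc k) + k * x + x  ≡⟨ shuffle k (n C suc k) x ⟩
    suc k * (x + n C suc k)          ≡⟨ cong (suc k *_) (nCk+nC[k+1]≡[n+1]C[k+1] n k) ⟩
    suc k * (suc n C suc k)          ≡⟨ [k+1]*[n+1]C[k+1]≡[n+1]*nCk n k ⟩
    suc n * x                        ≡⟨ +-comm x (n * x) ⟩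
    n * x + x                        ∎)
    where
    x = n C k
    shuffle : ∀ k y x → suc k * y + k * x + x ≡ suc k * (x + y)
    shuffle = solve-∀

  [k+1]*[m+k]C[k+1]≡m*[m+k]Ck : ∀ m k → suc k * ((m + k) C suc k) ≡ m * ((m + k) C k)
  [k+1]*[m+k]C[k+1]≡m*[m+k]Ck m k = +-cancelʳ-≡ (k * x) _ _ (begin
    suc k * ((m + k) C suc k) + k * x  ≡⟨ [k+1]*nC[k+1]+k*nCk≡n*nCk (m + k) k ⟩
    (m + k) * x                        ≡⟨ *-distribʳ-+ x m k ⟩
    m * x + k * x                      ∎)
    where x = (m + k) C k

  nCk*[k!*m!]≡n! : ∀ {n} k m → k + m ≡ n → (n C k) * (k ! * m !) ≡ n !
  nCk*[k!*m!]≡n! zero    m refl = trans (*-identityˡ _) (*-identityˡ (m !))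
  nCk*[k!*m!]≡n! (suc k) m refl = begin
    (suc (k + m) C suc k) * ((suc k * k !) * m !)  ≡⟨ cong ((suc (k + m) C suc k) *_) (*-assoc (suc k) (k !) (m !)) ⟩
    (suc (k + m) C suc k) * (suc k * (k ! * m !))  ≡⟨ x∙yz≈yx∙z (suc (k + m) C suc k) (suc k) _ ⟩
    (suc k * (suc (k + m) C suc k)) * (k ! * m !)  ≡⟨ cong (_* (k ! * m !)) ([k+1]*[n+1]C[k+1]≡[n+1]*nCk (k + m) k) ⟩
    (suc (k + m) * ((k + m) C k)) * (k ! * m !)    ≡⟨ *-assoc (suc (k + m)) ((k + m) C k) (k ! * m !) ⟩
    suc (k + m) * (((k + m) C k) * (k ! * m !))    ≡⟨ cong (suc (k + m) *_) (nCk*[k!*m!]≡n! k m refl) ⟩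
    suc (k + m) !                                  ∎

  legendreCoeff : ℕ → ℕ → ℕ
  legendreCoeff l k = (l C k) * ((l + k) C k)

  legendreCoeff≡[2k]Ck*[l+k]C[2k] : ∀ l k {a e} → l + k ≡ a → k + k ≡ e → legendreCoeff l k ≡ (e C k) * (a C e)
  legendreCoeff≡[2k]Ck*[l+k]C[2k] l k {a} {e} refl k+k≡e with k ≤? l
  ... | no k≰l = begin
    (l C k) * (a C k)  ≡⟨ cong (_* (a C k)) (k>n⇒nCk≡0 (≰⇒> k≰l)) ⟩
    0                  ≡⟨ *-zeroʳ (e C k) ⟨
    (e C k) * 0        ≡⟨ cong ((e C k) *_) (k>n⇒nCk≡0 a<e) ⟨
    (e C k) * (a C e)  ∎
    where
    a<e : a < e
    a<e = subst (l + k <_) k+k≡e (+-monoˡ-< k (≰⇒> k≰l))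
  ... | yes k≤l with m≤n⇒∃[o]m+o≡n k≤l
  ...   | m , k+m≡l = *-cancelʳ-≡ _ _ (k ! * (k ! * m !)) {{m*n≢0 (k !) (k ! * m !) {{k !≢0}} {{k !* m !≢0}}}} (begin
    (l C k) * (a C k) * (k ! * (k ! * m !))    ≡⟨ shuffleˡ (l C k) (a C k) (k !) (k !) (m !) ⟩
    (a C k) * (k ! * ((l C k) * (k ! * m !)))  ≡⟨ cong (λ u → (a C k) * (k ! * u)) (nCk*[k!*m!]≡n! k m k+m≡l) ⟩
    (a C k) * (k ! * l !)                      ≡⟨ nCk*[k!*m!]≡n! k l (+-comm k l) ⟩
    a !                                        ≡⟨ nCk*[k!*m!]≡n! e m e+m≡a ⟨
    (a C e) * (e ! * m !)                      ≡⟨ cong (λ u → (a C e) * (u * m !)) (nCk*[k!*m!]≡n! k k k+k≡e) ⟨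
    (a C e) * ((e C k) * (k ! * k !) * m !)    ≡⟨ shuffleʳ (a C e) (e C k) (k !) (k !) (m !) ⟩
    (e C k) * (a C e) * (k ! * (k ! * m !))    ∎)
    where
    e+m≡a : e + m ≡ a
    e+m≡a = begin
      e + m        ≡⟨ cong (_+ m) k+k≡e ⟨
      k + k + m    ≡⟨ +-assoc k k m ⟩
      k + (k + m)  ≡⟨ cong (k +_) k+m≡l ⟩
      k + l        ≡⟨ +-comm k l ⟩
      l + k        ∎
    shuffleˡ : ∀ x y u v w → x * y * (u * (v * w)) ≡ y * (u * (x * (v * w)))
    shuffleˡ = solve-∀
    shuffleʳ : ∀ x y u v w → x * (y * (u * v) * w) ≡ y * x * (u * (v * w))
    shuffleʳ = solve-∀

  [j+1]*[2j+2]C[j+1]≡2*[2j+1]*[2j]Cj : ∀ j → suc j * (suc (suc (j + j)) C suc j) ≡ 2 * suc (j + j) * ((j + j) C j)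
  [j+1]*[2j+2]C[j+1]≡2*[2j+1]*[2j]Cj j = begin
    suc j * (suc (suc e) C suc j)  ≡⟨ [k+1]*[n+1]C[k+1]≡[n+1]*nCk (suc e) j ⟩
    suc (suc e) * (suc e C j)      ≡⟨ double j (suc e C j) ⟩
    2 * (suc j * (suc e C j))      ≡⟨ cong (2 *_) ([k+1]*[m+k]C[k+1]≡m*[m+k]Ck (suc j) j) ⟨
    2 * (suc j * (suc e C suc j))  ≡⟨ cong (2 *_) ([k+1]*[n+1]C[k+1]≡[n+1]*nCk e j) ⟩
    2 * (suc e * (e C j))          ≡⟨ *-assoc 2 (suc e) (e C j) ⟨
    2 * suc e * (e C j)            ∎
    where
    e = j + j
    double : ∀ j x → suc (suc (j + j)) * x ≡ 2 * (suc j * x)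
    double = solve-∀

  legendreCoeff-rec-absorption : ∀ n j →
    suc (j + j) * (suc (suc n) * ((n + suc j) C (j + j)) + (n + suc j) C suc (j + j)) ≡ suc j * (2 * n + 3) * ((n + suc j) C (j + j))
  legendreCoeff-rec-absorption n j = +-cancelʳ-≡ (e * x) _ _ (begin
    suc e * (suc (suc n) * x + y) + e * x             ≡⟨ distrib (suc e) (suc (suc n) * x) y (e * x) ⟩
    suc e * (suc (suc n) * x) + (suc e * y + e * x)   ≡⟨ cong (suc e * (suc (suc n) * x) +_) ([k+1]*nC[k+1]+k*nCk≡n*nCk a e) ⟩
    suc e * (suc (suc n) * x) + a * x                 ≡⟨ arith n j x ⟩
    suc j * (2 * n + 3) * x + e * x                   ∎)
    where
    e = j + j
    a = n + suc j
    x = a C e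
    y = a C suc e
    distrib : ∀ s u v w → s * (u + v) + w ≡ s * u + (s * v + w)
    distrib = solve-∀
    arith : ∀ n j x → suc (j + j) * (suc (suc n) * x) + (n + suc j) * x ≡ suc j * (2 * n + 3) * x + (j + j) * x
    arith = solve-∀

  legendreCoeff-rec-central : ∀ n j →
    (suc (suc (j + j)) C suc j) * (suc (suc n) * ((n + suc j) C (j + j)) + (n + suc j) C suc (j + j))
      ≡ 2 * (2 * n + 3) * ((j + j) C j) * ((n + suc j) C (j + j))
  legendreCoeff-rec-central n j = *-cancelˡ-≡ _ _ (suc j * suc (j + j)) (begin
    suc j * suc e * (c * w)                        ≡⟨ interchange (suc j) (suc e) c w ⟩
    (suc j * c) * (suc e * w)                      ≡⟨ cong₂ _*_ ([j+1]*[2j+2]C[j+1]≡2*[2j+1]*[2j]Cj j) (legendreCoeff-rec-absorption n j) ⟩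
    (2 * suc e * c′) * (suc j * (2 * n + 3) * x)   ≡⟨ collect (suc j) (suc e) n c′ x ⟩
    suc j * suc e * (2 * (2 * n + 3) * c′ * x)     ∎)
    where
    e = j + j
    c = suc (suc e) C suc j
    c′ = e C j
    x = (n + suc j) C e
    w = suc (suc n) * x + (n + suc j) C suc e
    interchange : ∀ p q r s → p * q * (r * s) ≡ (p * r) * (q * s)
    interchange = solve-∀
    collect : ∀ p q n c′ x → (2 * q * c′) * (p * (2 * n + 3) * x) ≡ p * q * (2 * (2 * n + 3) * c′ * x)
    collect = solve-∀

  legendreCoeff-rec-zero : ∀ n →
    suc (suc n) * legendreCoeff (suc (suc n)) 0 + suc n * legendreCoeff n 0 ≡ (2 * n + 3) * (legendreCoeff (suc n) 0 + 2 * 0)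
  legendreCoeff-rec-zero n = arith n
    where
    arith : ∀ n → suc (suc n) * 1 + suc n * 1 ≡ (2 * n + 3) * (1 + 2 * 0)
    arith = solve-∀

  legendreCoeff-rec-suc : ∀ n j →
    suc (suc n) * legendreCoeff (suc (suc n)) (suc j) + suc n * legendreCoeff n (suc j)
      ≡ (2 * n + 3) * (legendreCoeff (suc n) (suc j) + 2 * legendreCoeff (suc n) j)
  legendreCoeff-rec-suc n j = begin
    suc (suc n) * legendreCoeff (suc (suc n)) (suc j) + suc n * legendreCoeff n (suc j)
      ≡⟨ cong₂ (λ u v → suc (suc n) * u + suc n * v) (legendreCoeff≡[2k]Ck*[l+k]C[2k] (suc (suc n)) (suc j) refl 2[j+1]≡2+e)
                                                     (legendreCoeff≡[2k]Ck*[l+k]C[2k] n (suc j) refl 2[j+1]≡2+e) ⟩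
    suc (suc n) * (c * (suc (suc a) C suc (suc e))) + suc n * (c * z)
      ≡⟨ cong (λ u → suc (suc n) * (c * u) + suc n * (c * z)) [a+2]C[e+2]≡[x+y]+[y+z] ⟩
    suc (suc n) * (c * ((x + y) + (y + z))) + suc n * (c * z)
      ≡⟨ regroup n c x y z ⟩
    c * (suc (suc n) * x + y) + (2 * n + 3) * (c * (y + z))
      ≡⟨ cong (_+ (2 * n + 3) * (c * (y + z))) (legendreCoeff-rec-central n j) ⟩
    2 * (2 * n + 3) * c′ * x + (2 * n + 3) * (c * (y + z))
      ≡⟨ factor n c′ x (c * (y + z)) ⟩
    (2 * n + 3) * (c * (y + z) + 2 * (c′ * x))
      ≡⟨ cong₂ (λ u v → (2 * n + 3) * (c * u + 2 * v)) (nCk+nC[k+1]≡[n+1]C[k+1] a (suc e))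
                                                       (sym (legendreCoeff≡[2k]Ck*[l+k]C[2k] (suc n) j (sym (+-suc n j)) refl)) ⟩
    (2 * n + 3) * (c * (suc a C suc (suc e)) + 2 * legendreCoeff (suc n) j)
      ≡⟨ cong (λ u → (2 * n + 3) * (u + 2 * legendreCoeff (suc n) j)) (legendreCoeff≡[2k]Ck*[l+k]C[2k] (suc n) (suc j) refl 2[j+1]≡2+e) ⟨
    (2 * n + 3) * (legendreCoeff (suc n) (suc j) + 2 * legendreCoeff (suc n) j)
      ∎
    where
    e = j + j
    a = n + suc j
    c = suc (suc e) C suc j
    c′ = e C j
    x = a C e
    y = a C suc e
    z = a C suc (suc e)
    2[j+1]≡2+e : suc j + suc j ≡ suc (suc e)
    2[j+1]≡2+e = cong suc (+-suc j j)
    [a+2]C[e+2]≡[x+y]+[y+z] : suc (suc a) C suc (suc e) ≡ (x + y) + (y + z)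
    [a+2]C[e+2]≡[x+y]+[y+z] = sym (trans (cong₂ _+_ (nCk+nC[k+1]≡[n+1]C[k+1] a e) (nCk+nC[k+1]≡[n+1]C[k+1] a (suc e)))
                                         (nCk+nC[k+1]≡[n+1]C[k+1] (suc a) (suc e)))
    regroup : ∀ n c x y z → suc (suc n) * (c * ((x + y) + (y + z))) + suc n * (c * z)
                            ≡ c * (suc (suc n) * x + y) + (2 * n + 3) * (c * (y + z))
    regroup = solve-∀
    factor : ∀ n c′ x w → 2 * (2 * n + 3) * c′ * x + (2 * n + 3) * w ≡ (2 * n + 3) * (w + 2 * (c′ * x))
    factor = solve-∀

  [k+1]*lCk*[l+k]C[k+1]≡l*legendreCoeff : ∀ l k → suc k * ((l C k) * ((l + k) C suc k)) ≡ l * legendreCoeff l k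
  [k+1]*lCk*[l+k]C[k+1]≡l*legendreCoeff l k = begin
    suc k * ((l C k) * ((l + k) C suc k))  ≡⟨ x∙yz≈y∙xz (suc k) (l C k) _ ⟩
    (l C k) * (suc k * ((l + k) C suc k))  ≡⟨ cong ((l C k) *_) ([k+1]*[m+k]C[k+1]≡m*[m+k]Ck l k) ⟩
    (l C k) * (l * ((l + k) C k))          ≡⟨ x∙yz≈y∙xz (l C k) l _ ⟩
    l * legendreCoeff l k                  ∎

  [l+k]*lCk*[l+k-1]Ck≡l*legendreCoeff : ∀ m k → (suc m + k) * ((suc m C k) * ((m + k) C k)) ≡ suc m * legendreCoeff (suc m) k
  [l+k]*lCk*[l+k-1]Ck≡l*legendreCoeff m k = begin
    suc (m + k) * (x * ((m + k) C k))         ≡⟨ x∙yz≈y∙xz (suc (m + k)) x _ ⟩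
    x * (suc (m + k) * ((m + k) C k))         ≡⟨ cong (x *_) ([k+1]*[n+1]C[k+1]≡[n+1]*nCk (m + k) k) ⟨
    x * (suc k * (suc (m + k) C suc k))       ≡⟨ cong (x *_) ([k+1]*[m+k]C[k+1]≡m*[m+k]Ck (suc m) k) ⟩
    x * (suc m * (suc (m + k) C k))           ≡⟨ x∙yz≈y∙xz x (suc m) _ ⟩
    suc m * legendreCoeff (suc m) k           ∎
    where x = suc m C k

open import Data.List using ([]; _∷_; map; applyUpTo)
open import Data.Nat as ℕ using (ℕ; zero; suc; _≤_; z≤n; s≤s)
import Data.Nat.Properties as ℕ
open import Data.Nat.Coprimality using (1-coprimeTo) renaming (sym to coprime-sym)
import Data.Integer as ℤ
import Data.Integer.Properties as ℤ
open import Data.Rational using (ℚ; mkℚ; 0ℚ; 1ℚ; _+_; _*_; -_; _/_)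
open import Data.Rational.Properties
  using ( normalize-coprime; *-inverseˡ; +-identityˡ; +-identityʳ; +-comm; *-zeroˡ; *-zeroʳ; *-identityˡ; *-assoc
        ; *-distribˡ-+; *-distribʳ-+; *-1-commutativeMonoid; +-0-commutativeMonoid)
open import Data.Rational.Solver using (module +-*-Solver)
open import Algebra.Bundles using (CommutativeMonoid)
import Algebra.Properties.CommutativeSemigroup as CommSemigroupProperties
open import Function using (_∘_)
open import Level using (0ℓ)
open import Relation.Binary.Bundles using (Setoid)
import Relation.Binary.Reasoning.Setoid as SetoidReasoning

open Binomial
open +-*-Solver using (solve; _:=_; _:+_; _:*_; :-_; con)
open CommSemigroupProperties (CommutativeMonoid.commutativeSemigroup *-1-commutativeMonoid) using (x∙yz≈y∙xz)
open CommSemigroupProperties (CommutativeMonoid.commutativeSemigroup +-0-commutativeMonoid) using (interchange)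

-- `+ n / 1` normalises through a gcd that does not reduce for variable n; `mkℚ` is computable.
ℕtoℚ≡mkℚ : ∀ n → ℕtoℚ n ≡ mkℚ (ℤ.+ n) 0 (coprime-sym (1-coprimeTo n))
ℕtoℚ≡mkℚ n = normalize-coprime (coprime-sym (1-coprimeTo n))

ℕtoℚ-+ : ∀ m n → ℕtoℚ (m ℕ.+ n) ≡ ℕtoℚ m + ℕtoℚ n
ℕtoℚ-+ m n rewrite ℕtoℚ≡mkℚ m | ℕtoℚ≡mkℚ n =
  cong (_/ 1) (trans (ℤ.pos-+ m n) (sym (cong₂ ℤ._+_ (ℤ.*-identityʳ (ℤ.+ m)) (ℤ.*-identityʳ (ℤ.+ n)))))

ℕtoℚ-* : ∀ m n → ℕtoℚ (m ℕ.* n) ≡ ℕtoℚ m * ℕtoℚ n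
ℕtoℚ-* m n rewrite ℕtoℚ≡mkℚ m | ℕtoℚ≡mkℚ n = cong (_/ 1) (ℤ.pos-* m n)

inv*ℕtoℚ≡1 : ∀ n → inv (suc n) * ℕtoℚ (suc n) ≡ 1ℚ
inv*ℕtoℚ≡1 n rewrite ℕtoℚ≡mkℚ (suc n) | normalize-coprime {1} {n} (1-coprimeTo (suc n)) =
  *-inverseˡ (mkℚ (ℤ.+ suc n) 0 (coprime-sym (1-coprimeTo (suc n))))

inv-cancelˡ : ∀ n x → inv (suc n) * (ℕtoℚ (suc n) * x) ≡ x
inv-cancelˡ n x = begin
  inv (suc n) * (ℕtoℚ (suc n) * x)  ≡⟨ *-assoc (inv (suc n)) (ℕtoℚ (suc n)) x ⟨
  inv (suc n) * ℕtoℚ (suc n) * x    ≡⟨ cong (_* x) (inv*ℕtoℚ≡1 n) ⟩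
  1ℚ * x                            ≡⟨ *-identityˡ x ⟩
  x                                 ∎
  where open ≡-Reasoning

sgn*sgn≡1 : ∀ n → sgn n * sgn n ≡ 1ℚ
sgn*sgn≡1 zero    = refl
sgn*sgn≡1 (suc n) = trans (solve 1 (λ s → (:- s) :* (:- s) := s :* s) refl (sgn n)) (sgn*sgn≡1 n)

-- `_≈P_` unfolds to equations between `coeff` applications, from which unification cannot recover
-- the polynomials; this record wrapper is injective, so the algebra below can leave them implicit.
record _≋_ (p q : Poly) : Set where
  constructor ≈P⇒≋
  field ≋⇒≈P : p ≈P q
open _≋_ public
infix 4 _≋_

≋-setoid : Setoid 0ℓ 0ℓ
≋-setoid = record
  { Carrier       = Poly
  ; _≈_           = _≋_
  ; isEquivalence = record
    { refl  = ≈P⇒≋ λ _ → refl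
    ; sym   = λ p≋q → ≈P⇒≋ λ k → sym (≋⇒≈P p≋q k)
    ; trans = λ p≋q q≋r → ≈P⇒≋ λ k → trans (≋⇒≈P p≋q k) (≋⇒≈P q≋r k)
    }
  }

open Setoid ≋-setoid public using () renaming (refl to ≋-refl; reflexive to ≋-reflexive; sym to ≋-sym; trans to ≋-trans)
module ≋-Reasoning = SetoidReasoning ≋-setoid

coeff-⊕ : ∀ p q k → coeff (p ⊕ q) k ≡ coeff p k + coeff q k
coeff-⊕ []      q       k       = sym (+-identityˡ (coeff q k))
coeff-⊕ (a ∷ p) []      k       = sym (+-identityʳ (coeff (a ∷ p) k))
coeff-⊕ (a ∷ p) (b ∷ q) zero    = refl
coeff-⊕ (a ∷ p) (b ∷ q) (suc k) = coeff-⊕ p q k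

coeff-· : ∀ c p k → coeff (c · p) k ≡ c * coeff p k
coeff-· c []      k       = sym (*-zeroʳ c)
coeff-· c (a ∷ p) zero    = refl
coeff-· c (a ∷ p) (suc k) = coeff-· c p k

∷-cong : ∀ {a b p q} → a ≡ b → p ≋ q → a ∷ p ≋ b ∷ q
∷-cong a≡b p≋q = ≈P⇒≋ λ { zero → a≡b ; (suc k) → ≋⇒≈P p≋q k }

⊕-cong : ∀ {p p′ q q′} → p ≋ p′ → q ≋ q′ → p ⊕ q ≋ p′ ⊕ q′
⊕-cong {p} {p′} {q} {q′} p≋p′ q≋q′ = ≈P⇒≋ λ k →
  trans (coeff-⊕ p q k) (trans (cong₂ _+_ (≋⇒≈P p≋p′ k) (≋⇒≈P q≋q′ k)) (sym (coeff-⊕ p′ q′ k)))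

⊕-congˡ : ∀ p {q q′} → q ≋ q′ → p ⊕ q ≋ p ⊕ q′
⊕-congˡ p = ⊕-cong (≋-refl {p})

·-congˡ : ∀ c {p q} → p ≋ q → c · p ≋ c · q
·-congˡ c {p} {q} p≋q = ≈P⇒≋ λ k →
  trans (coeff-· c p k) (trans (cong (c *_) (≋⇒≈P p≋q k)) (sym (coeff-· c q k)))

⊕-identityʳ : ∀ p → p ⊕ [] ≡ p
⊕-identityʳ []      = refl
⊕-identityʳ (a ∷ p) = refl

const0⊕p≋p : ∀ p → const 0ℚ ⊕ p ≋ p
const0⊕p≋p []      = ≈P⇒≋ λ { zero → refl ; (suc k) → refl }
const0⊕p≋p (b ∷ p) = ∷-cong (+-identityˡ b) ≋-refl

⊕-comm : ∀ p q → p ⊕ q ≋ q ⊕ p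
⊕-comm p q = ≈P⇒≋ λ k → trans (coeff-⊕ p q k) (trans (+-comm (coeff p k) (coeff q k)) (sym (coeff-⊕ q p k)))

⊕-interchange : ∀ p q r s → (p ⊕ q) ⊕ (r ⊕ s) ≋ (p ⊕ r) ⊕ (q ⊕ s)
⊕-interchange p q r s = ≈P⇒≋ λ k →
  trans (expand p q r s k) (trans (interchange (coeff p k) (coeff q k) (coeff r k) (coeff s k)) (sym (expand p r q s k)))
  where
  expand : ∀ w x y z k → coeff ((w ⊕ x) ⊕ (y ⊕ z)) k ≡ (coeff w k + coeff x k) + (coeff y k + coeff z k)
  expand w x y z k = trans (coeff-⊕ (w ⊕ x) (y ⊕ z) k) (cong₂ _+_ (coeff-⊕ w x k) (coeff-⊕ y z k))

·-distribˡ-⊕ : ∀ c p q → c · (p ⊕ q) ≋ c · p ⊕ c · q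
·-distribˡ-⊕ c p q = ≈P⇒≋ λ k → begin
  coeff (c · (p ⊕ q)) k            ≡⟨ trans (coeff-· c (p ⊕ q) k) (cong (c *_) (coeff-⊕ p q k)) ⟩
  c * (coeff p k + coeff q k)      ≡⟨ *-distribˡ-+ c (coeff p k) (coeff q k) ⟩
  c * coeff p k + c * coeff q k    ≡⟨ trans (coeff-⊕ (c · p) (c · q) k) (cong₂ _+_ (coeff-· c p k) (coeff-· c q k)) ⟨
  coeff (c · p ⊕ c · q) k          ∎
  where open ≡-Reasoning

·-·-comm : ∀ c d p → c · (d · p) ≋ d · (c · p)
·-·-comm c d p = ≈P⇒≋ λ k → begin
  coeff (c · (d · p)) k   ≡⟨ trans (coeff-· c (d · p) k) (cong (c *_) (coeff-· d p k)) ⟩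
  c * (d * coeff p k)     ≡⟨ x∙yz≈y∙xz c d (coeff p k) ⟩
  d * (c * coeff p k)     ≡⟨ trans (coeff-· d (c · p) k) (cong (d *_) (coeff-· c p k)) ⟨
  coeff (d · (c · p)) k   ∎
  where open ≡-Reasoning

⊗-zeroʳ : ∀ p → p ⊗ [] ≋ []
⊗-zeroʳ []      = ≋-refl
⊗-zeroʳ (a ∷ p) = ≈P⇒≋ λ { zero → refl ; (suc k) → ≋⇒≈P (⊗-zeroʳ p) k }

⊗-congˡ : ∀ p {q r} → q ≋ r → p ⊗ q ≋ p ⊗ r
⊗-congˡ []      q≋r = ≋-refl
⊗-congˡ (a ∷ p) q≋r = ⊕-cong (·-congˡ a q≋r) (∷-cong refl (⊗-congˡ p q≋r))

⊗-distribˡ-⊕ : ∀ p q r → p ⊗ (q ⊕ r) ≋ p ⊗ q ⊕ p ⊗ r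
⊗-distribˡ-⊕ []      q r = ≋-refl
⊗-distribˡ-⊕ (a ∷ p) q r = begin
  a · (q ⊕ r) ⊕ (0ℚ ∷ p ⊗ (q ⊕ r))                   ≈⟨ ⊕-cong (·-distribˡ-⊕ a q r) (∷-cong refl (⊗-distribˡ-⊕ p q r)) ⟩
  (a · q ⊕ a · r) ⊕ ((0ℚ ∷ p ⊗ q) ⊕ (0ℚ ∷ p ⊗ r))    ≈⟨ ⊕-interchange (a · q) (a · r) (0ℚ ∷ p ⊗ q) (0ℚ ∷ p ⊗ r) ⟩
  (a · q ⊕ (0ℚ ∷ p ⊗ q)) ⊕ (a · r ⊕ (0ℚ ∷ p ⊗ r))    ∎
  where open ≋-Reasoning

⊗-·-comm : ∀ p c q → p ⊗ (c · q) ≋ c · (p ⊗ q)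
⊗-·-comm []      c q = ≋-refl
⊗-·-comm (a ∷ p) c q = begin
  a · (c · q) ⊕ (0ℚ ∷ p ⊗ (c · q))       ≈⟨ ⊕-cong (·-·-comm a c q) (∷-cong (sym (*-zeroʳ c)) (⊗-·-comm p c q)) ⟩
  c · (a · q) ⊕ c · (0ℚ ∷ p ⊗ q)         ≈⟨ ≋-sym (·-distribˡ-⊕ c (a · q) (0ℚ ∷ p ⊗ q)) ⟩
  c · (a · q ⊕ (0ℚ ∷ p ⊗ q))             ∎
  where open ≋-Reasoning

compose-≋[] : ∀ {p} q → p ≋ [] → compose p q ≋ []
compose-≋[] {[]}    q _    = ≋-refl
compose-≋[] {a ∷ p} q p≋[] = begin
  const a ⊕ q ⊗ compose p q    ≈⟨ ⊕-cong (∷-cong (≋⇒≈P p≋[] 0) ≋-refl) (⊗-congˡ q (compose-≋[] q (≈P⇒≋ {p} (≋⇒≈P p≋[] ∘ suc)))) ⟩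
  const 0ℚ ⊕ q ⊗ []           ≈⟨ const0⊕p≋p (q ⊗ []) ⟩
  q ⊗ []                      ≈⟨ ⊗-zeroʳ q ⟩
  []                          ∎
  where open ≋-Reasoning

compose-congˡ : ∀ {p p′} q → p ≋ p′ → compose p q ≋ compose p′ q
compose-congˡ {[]}    {[]}     q _     = ≋-refl
compose-congˡ {[]}    {b ∷ p′} q p≋p′ = ≋-sym (compose-≋[] q (≋-sym p≋p′))
compose-congˡ {a ∷ p} {[]}     q p≋p′ = compose-≋[] q p≋p′
compose-congˡ {a ∷ p} {b ∷ p′} q p≋p′ =
  ⊕-cong (∷-cong (≋⇒≈P p≋p′ 0) ≋-refl) (⊗-congˡ q (compose-congˡ q (≈P⇒≋ {p} {p′} (≋⇒≈P p≋p′ ∘ suc))))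

compose-⊕ : ∀ p p′ q → compose (p ⊕ p′) q ≋ compose p q ⊕ compose p′ q
compose-⊕ []      p′       q = ≋-refl
compose-⊕ (a ∷ p) []       q = ≋-reflexive (sym (⊕-identityʳ (compose (a ∷ p) q)))
compose-⊕ (a ∷ p) (b ∷ p′) q = begin
  (const a ⊕ const b) ⊕ q ⊗ compose (p ⊕ p′) q                      ≈⟨ ⊕-congˡ (const a ⊕ const b) (⊗-congˡ q (compose-⊕ p p′ q)) ⟩
  (const a ⊕ const b) ⊕ q ⊗ (compose p q ⊕ compose p′ q)            ≈⟨ ⊕-congˡ (const a ⊕ const b) (⊗-distribˡ-⊕ q (compose p q) (compose p′ q)) ⟩
  (const a ⊕ const b) ⊕ (q ⊗ compose p q ⊕ q ⊗ compose p′ q)        ≈⟨ ⊕-interchange (const a) (const b) (q ⊗ compose p q) (q ⊗ compose p′ q) ⟩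
  (const a ⊕ q ⊗ compose p q) ⊕ (const b ⊕ q ⊗ compose p′ q)        ∎
  where open ≋-Reasoning

compose-· : ∀ c p q → compose (c · p) q ≋ c · compose p q
compose-· c []      q = ≋-refl
compose-· c (a ∷ p) q = begin
  c · const a ⊕ q ⊗ compose (c · p) q     ≈⟨ ⊕-congˡ (c · const a) (⊗-congˡ q (compose-· c p q)) ⟩
  c · const a ⊕ q ⊗ (c · compose p q)     ≈⟨ ⊕-congˡ (c · const a) (⊗-·-comm q c (compose p q)) ⟩
  c · const a ⊕ c · (q ⊗ compose p q)     ≈⟨ ≋-sym (·-distribˡ-⊕ c (const a) (q ⊗ compose p q)) ⟩
  c · (const a ⊕ q ⊗ compose p q)         ∎
  where open ≋-Reasoning

coeff-∷⊗ : ∀ a p q k → coeff ((a ∷ p) ⊗ q) k ≡ a * coeff q k + coeff (0ℚ ∷ p ⊗ q) k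
coeff-∷⊗ a p q k = trans (coeff-⊕ (a · q) (0ℚ ∷ p ⊗ q) k) (cong (_+ coeff (0ℚ ∷ p ⊗ q) k) (coeff-· a q k))

coeff-linear⊗ : ∀ b a p k → coeff ((b ∷ a ∷ []) ⊗ p) k ≡ b * coeff p k + a * coeff (0ℚ ∷ p) k
coeff-linear⊗ b a p k = begin
  coeff ((b ∷ a ∷ []) ⊗ p) k                           ≡⟨ coeff-∷⊗ b (a ∷ []) p k ⟩
  b * coeff p k + coeff (0ℚ ∷ (a ∷ []) ⊗ p) k          ≡⟨ cong (b * coeff p k +_) (≋⇒≈P a∷[]⊗p≋a·0∷p k) ⟩
  b * coeff p k + coeff (a · (0ℚ ∷ p)) k               ≡⟨ cong (b * coeff p k +_) (coeff-· a (0ℚ ∷ p) k) ⟩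
  b * coeff p k + a * coeff (0ℚ ∷ p) k                 ∎
  where
  open ≡-Reasoning
  a∷[]⊗p≋a·0∷p : 0ℚ ∷ (a ∷ []) ⊗ p ≋ a · (0ℚ ∷ p)
  a∷[]⊗p≋a·0∷p = ∷-cong (sym (*-zeroʳ a)) (≋-trans (⊕-comm (a · p) (const 0ℚ)) (const0⊕p≋p (a · p)))

T⊗p≋0∷p : ∀ p → T ⊗ p ≋ 0ℚ ∷ p
T⊗p≋0∷p p = ≈P⇒≋ λ k → begin
  coeff (T ⊗ p) k                                   ≡⟨ coeff-linear⊗ 0ℚ 1ℚ p k ⟩
  0ℚ * coeff p k + 1ℚ * coeff (0ℚ ∷ p) k            ≡⟨ solve 2 (λ x y → con 0ℚ :* x :+ con 1ℚ :* y := y) refl (coeff p k) (coeff (0ℚ ∷ p) k) ⟩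
  coeff (0ℚ ∷ p) k                                  ∎
  where open ≡-Reasoning

compose-T⊗ : ∀ p q → compose (T ⊗ p) q ≋ q ⊗ compose p q
compose-T⊗ p q = ≋-trans (compose-congˡ q (T⊗p≋0∷p p)) (const0⊕p≋p (q ⊗ compose p q))

-- `deriv` delegates to a local helper that cannot be named outside `Defs`; `derivFrom` is that
-- helper, found by solving the metavariable below. Abstracting its arguments apart with `with`
-- turns `deriv-∷-∷` into a pattern-unification problem.
mutual
  derivFrom : ℚ → Poly → ℕ → Poly → Poly
  derivFrom = _

  deriv-∷-∷ : ∀ a x q → deriv (a ∷ x ∷ q) ≡ (ℕtoℚ 1 * x) ∷ derivFrom a (x ∷ q) 2 q
  deriv-∷-∷ a x q with x ∷ q
  ... | p with 2 | q
  ...   | n | r = refl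

coeff-derivFrom : ∀ a p n q k → coeff (derivFrom a p n q) k ≡ ℕtoℚ (n ℕ.+ k) * coeff q k
coeff-derivFrom a p n []      k       = sym (*-zeroʳ (ℕtoℚ (n ℕ.+ k)))
coeff-derivFrom a p n (x ∷ q) zero    = cong (λ m → ℕtoℚ m * x) (sym (ℕ.+-identityʳ n))
coeff-derivFrom a p n (x ∷ q) (suc k) =
  trans (coeff-derivFrom a p (suc n) q k) (cong (λ m → ℕtoℚ m * coeff q k) (sym (ℕ.+-suc n k)))

coeff-deriv : ∀ p k → coeff (deriv p) k ≡ ℕtoℚ (suc k) * coeff p (suc k)
coeff-deriv []            k       = sym (*-zeroʳ (ℕtoℚ (suc k)))
coeff-deriv (a ∷ [])      k       = sym (*-zeroʳ (ℕtoℚ (suc k)))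
coeff-deriv (a ∷ x ∷ q)   zero    = refl
coeff-deriv (a ∷ x ∷ q)   (suc k) = trans (cong (λ r → coeff r (suc k)) (deriv-∷-∷ a x q)) (coeff-derivFrom a (x ∷ q) 2 q k)

coeff-T⊗deriv : ∀ p k → coeff (T ⊗ deriv p) k ≡ ℕtoℚ k * coeff p k
coeff-T⊗deriv p zero    = trans (≋⇒≈P (T⊗p≋0∷p (deriv p)) 0) (sym (*-zeroˡ (coeff p 0)))
coeff-T⊗deriv p (suc k) = trans (≋⇒≈P (T⊗p≋0∷p (deriv p)) (suc k)) (coeff-deriv p k)

coeff-⊕-T⊗deriv : ∀ p k → coeff (p ⊕ T ⊗ deriv p) k ≡ ℕtoℚ (suc k) * coeff p k
coeff-⊕-T⊗deriv p k = begin
  coeff (p ⊕ T ⊗ deriv p) k            ≡⟨ trans (coeff-⊕ p (T ⊗ deriv p) k) (cong (coeff p k +_) (coeff-T⊗deriv p k)) ⟩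
  coeff p k + ℕtoℚ k * coeff p k       ≡⟨ cong (_+ ℕtoℚ k * coeff p k) (*-identityˡ (coeff p k)) ⟨
  1ℚ * coeff p k + ℕtoℚ k * coeff p k  ≡⟨ *-distribʳ-+ (coeff p k) 1ℚ (ℕtoℚ k) ⟨
  (1ℚ + ℕtoℚ k) * coeff p k            ≡⟨ cong (_* coeff p k) (ℕtoℚ-+ 1 k) ⟨
  ℕtoℚ (suc k) * coeff p k             ∎
  where open ≡-Reasoning

deriv-T⊗ : ∀ p → deriv (T ⊗ p) ≋ p ⊕ T ⊗ deriv p
deriv-T⊗ p = ≈P⇒≋ λ k → begin
  coeff (deriv (T ⊗ p)) k                 ≡⟨ coeff-deriv (T ⊗ p) k ⟩
  ℕtoℚ (suc k) * coeff (T ⊗ p) (suc k)    ≡⟨ cong (ℕtoℚ (suc k) *_) (≋⇒≈P (T⊗p≋0∷p p) (suc k)) ⟩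
  ℕtoℚ (suc k) * coeff p k                ≡⟨ coeff-⊕-T⊗deriv p k ⟨
  coeff (p ⊕ T ⊗ deriv p) k               ∎
  where open ≡-Reasoning

shiftedLegendre-rec : ∀ n → shiftedLegendre (suc (suc n)) ≋
  inv (suc (suc n)) · (ℕtoℚ (2 ℕ.* n ℕ.+ 3) · ((- 1ℚ ∷ ℕtoℚ 2 ∷ []) ⊗ shiftedLegendre (suc n))
                       ⊕ (- ℕtoℚ (suc n)) · shiftedLegendre n)
shiftedLegendre-rec n = begin
  compose (I · (A · (T ⊗ P₁) ⊕ B · P₀)) q                    ≈⟨ compose-· I (A · (T ⊗ P₁) ⊕ B · P₀) q ⟩
  I · compose (A · (T ⊗ P₁) ⊕ B · P₀) q                      ≈⟨ ·-congˡ I (compose-⊕ (A · (T ⊗ P₁)) (B · P₀) q) ⟩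
  I · (compose (A · (T ⊗ P₁)) q ⊕ compose (B · P₀) q)        ≈⟨ ·-congˡ I (⊕-cong (compose-· A (T ⊗ P₁) q) (compose-· B P₀ q)) ⟩
  I · (A · compose (T ⊗ P₁) q ⊕ B · compose P₀ q)            ≈⟨ ·-congˡ I (⊕-cong (·-congˡ A (compose-T⊗ P₁ q)) ≋-refl) ⟩
  I · (A · (q ⊗ compose P₁ q) ⊕ B · compose P₀ q)            ∎
  where
  open ≋-Reasoning
  I = inv (suc (suc n))
  A = ℕtoℚ (2 ℕ.* n ℕ.+ 3)
  B = - ℕtoℚ (suc n)
  P₁ = Legendre (suc n)
  P₀ = Legendre n
  q = - 1ℚ ∷ ℕtoℚ 2 ∷ []

-- One coefficient of the shifted Bonnet recurrence, with s = sgn n and t = - sgn k: c₁, c₁′ and c₀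
-- are coefficient k of P̃ (n+1), k-1 of P̃ (n+1) and k of P̃ n, and the l's are the absolute values.
bonnet-step : ∀ s t i n₂ n₁ a l₂ l₁ l₁′ l₀ {c₁ c₁′ c₀} →
  c₁ ≡ (- s) * ((- t) * l₁) → c₁′ ≡ (- s) * (t * l₁′) → c₀ ≡ s * ((- t) * l₀) →
  i * n₂ ≡ 1ℚ → n₂ * l₂ + n₁ * l₀ ≡ a * (l₁ + ℕtoℚ 2 * l₁′) →
  (- (- s)) * ((- t) * l₂) ≡ i * (a * ((- 1ℚ) * c₁ + ℕtoℚ 2 * c₁′) + (- n₁) * c₀)
bonnet-step s t i n₂ n₁ a l₂ l₁ l₁′ l₀ refl refl refl i*n₂≡1 rec = begin
  (- (- s)) * ((- t) * l₂)
    ≡⟨ *-identityˡ _ ⟨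
  1ℚ * ((- (- s)) * ((- t) * l₂))
    ≡⟨ cong (_* ((- (- s)) * ((- t) * l₂))) i*n₂≡1 ⟨
  i * n₂ * ((- (- s)) * ((- t) * l₂))
    ≡⟨ *-assoc i n₂ _ ⟩
  i * (n₂ * ((- (- s)) * ((- t) * l₂)))
    ≡⟨ cong (i *_) (solve 6 (λ s t n₂ n₁ l₂ l₀ → n₂ :* ((:- (:- s)) :* ((:- t) :* l₂))
                                := (:- (s :* t)) :* (n₂ :* l₂ :+ n₁ :* l₀) :+ s :* t :* (n₁ :* l₀)) refl s t n₂ n₁ l₂ l₀) ⟩
  i * ((- (s * t)) * (n₂ * l₂ + n₁ * l₀) + s * t * (n₁ * l₀))
    ≡⟨ cong (λ x → i * ((- (s * t)) * x + s * t * (n₁ * l₀))) rec ⟩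
  i * ((- (s * t)) * (a * (l₁ + ℕtoℚ 2 * l₁′)) + s * t * (n₁ * l₀))
    ≡⟨ cong (i *_) (solve 7 (λ s t n₁ a l₁ l₁′ l₀ → (:- (s :* t)) :* (a :* (l₁ :+ con (ℕtoℚ 2) :* l₁′)) :+ s :* t :* (n₁ :* l₀)
                                := a :* (con (- 1ℚ) :* ((:- s) :* ((:- t) :* l₁)) :+ con (ℕtoℚ 2) :* ((:- s) :* (t :* l₁′))) :+ (:- n₁) :* (s :* ((:- t) :* l₀)))
                              refl s t n₁ a l₁ l₁′ l₀) ⟩
  i * (a * ((- 1ℚ) * ((- s) * ((- t) * l₁)) + ℕtoℚ 2 * ((- s) * (t * l₁′))) + (- n₁) * (s * ((- t) * l₀)))
    ∎
  where open ≡-Reasoning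

coeff-shiftedLegendre-rec : ∀ n k → coeff (shiftedLegendre (suc (suc n))) k ≡
  inv (suc (suc n)) * (ℕtoℚ (2 ℕ.* n ℕ.+ 3) * ((- 1ℚ) * coeff (shiftedLegendre (suc n)) k + ℕtoℚ 2 * coeff (0ℚ ∷ shiftedLegendre (suc n)) k)
                       + (- ℕtoℚ (suc n)) * coeff (shiftedLegendre n) k)
coeff-shiftedLegendre-rec n k = begin
  coeff (shiftedLegendre (suc (suc n))) k                   ≡⟨ ≋⇒≈P (shiftedLegendre-rec n) k ⟩
  coeff (I · (A · (q ⊗ P̃₁) ⊕ B · P̃₀)) k                    ≡⟨ coeff-· I (A · (q ⊗ P̃₁) ⊕ B · P̃₀) k ⟩
  I * coeff (A · (q ⊗ P̃₁) ⊕ B · P̃₀) k                      ≡⟨ cong (I *_) (coeff-⊕ (A · (q ⊗ P̃₁)) (B · P̃₀) k) ⟩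
  I * (coeff (A · (q ⊗ P̃₁)) k + coeff (B · P̃₀) k)          ≡⟨ cong (I *_) (cong₂ _+_ (coeff-· A (q ⊗ P̃₁) k) (coeff-· B P̃₀ k)) ⟩
  I * (A * coeff (q ⊗ P̃₁) k + B * coeff P̃₀ k)              ≡⟨ cong (λ x → I * (A * x + B * coeff P̃₀ k)) (coeff-linear⊗ (- 1ℚ) (ℕtoℚ 2) P̃₁ k) ⟩
  I * (A * ((- 1ℚ) * coeff P̃₁ k + ℕtoℚ 2 * coeff (0ℚ ∷ P̃₁) k) + B * coeff P̃₀ k) ∎
  where
  open ≡-Reasoning
  I = inv (suc (suc n))
  A = ℕtoℚ (2 ℕ.* n ℕ.+ 3)
  B = - ℕtoℚ (suc n)
  P̃₁ = shiftedLegendre (suc n)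
  P̃₀ = shiftedLegendre n
  q = - 1ℚ ∷ ℕtoℚ 2 ∷ []

ℕtoℚ-recurrence : ∀ n l₂ l₁ l₁′ l₀ → suc (suc n) ℕ.* l₂ ℕ.+ suc n ℕ.* l₀ ≡ (2 ℕ.* n ℕ.+ 3) ℕ.* (l₁ ℕ.+ 2 ℕ.* l₁′) →
  ℕtoℚ (suc (suc n)) * ℕtoℚ l₂ + ℕtoℚ (suc n) * ℕtoℚ l₀ ≡ ℕtoℚ (2 ℕ.* n ℕ.+ 3) * (ℕtoℚ l₁ + ℕtoℚ 2 * ℕtoℚ l₁′)
ℕtoℚ-recurrence n l₂ l₁ l₁′ l₀ rec = begin
  ℕtoℚ (suc (suc n)) * ℕtoℚ l₂ + ℕtoℚ (suc n) * ℕtoℚ l₀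
    ≡⟨ trans (ℕtoℚ-+ (suc (suc n) ℕ.* l₂) (suc n ℕ.* l₀)) (cong₂ _+_ (ℕtoℚ-* (suc (suc n)) l₂) (ℕtoℚ-* (suc n) l₀)) ⟨
  ℕtoℚ (suc (suc n) ℕ.* l₂ ℕ.+ suc n ℕ.* l₀)
    ≡⟨ cong ℕtoℚ rec ⟩
  ℕtoℚ ((2 ℕ.* n ℕ.+ 3) ℕ.* (l₁ ℕ.+ 2 ℕ.* l₁′))
    ≡⟨ trans (ℕtoℚ-* (2 ℕ.* n ℕ.+ 3) (l₁ ℕ.+ 2 ℕ.* l₁′)) (cong (A *_) (trans (ℕtoℚ-+ l₁ (2 ℕ.* l₁′)) (cong (ℕtoℚ l₁ +_) (ℕtoℚ-* 2 l₁′)))) ⟩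
  ℕtoℚ (2 ℕ.* n ℕ.+ 3) * (ℕtoℚ l₁ + ℕtoℚ 2 * ℕtoℚ l₁′)
    ∎
  where
  open ≡-Reasoning
  A = ℕtoℚ (2 ℕ.* n ℕ.+ 3)

x*[y*0]≡0 : ∀ x y → x * (y * 0ℚ) ≡ 0ℚ
x*[y*0]≡0 x y = trans (cong (x *_) (*-zeroʳ y)) (*-zeroʳ x)

coeff-shiftedLegendre : ∀ l k → coeff (shiftedLegendre l) k ≡ sgn l * (sgn k * ℕtoℚ (legendreCoeff l k))
coeff-shiftedLegendre 0 0                   = refl
coeff-shiftedLegendre 0 (suc zero)          = refl
coeff-shiftedLegendre 0 (suc (suc k))       = sym (x*[y*0]≡0 (sgn 0) (sgn (suc (suc k))))
coeff-shiftedLegendre 1 0                   = refl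
coeff-shiftedLegendre 1 1                   = refl
coeff-shiftedLegendre 1 (suc (suc zero))    = refl
coeff-shiftedLegendre 1 (suc (suc (suc k))) = sym (x*[y*0]≡0 (sgn 1) (sgn (suc (suc (suc k)))))
coeff-shiftedLegendre (suc (suc n)) zero = trans (coeff-shiftedLegendre-rec n 0) (sym (
  bonnet-step (sgn n) (- 1ℚ) (inv (suc (suc n))) (ℕtoℚ (suc (suc n))) (ℕtoℚ (suc n)) (ℕtoℚ (2 ℕ.* n ℕ.+ 3)) 1ℚ 1ℚ 0ℚ 1ℚ
    (coeff-shiftedLegendre (suc n) 0) (sym (*-zeroʳ (- sgn n))) (coeff-shiftedLegendre n 0)
    (inv*ℕtoℚ≡1 (suc n)) (ℕtoℚ-recurrence n 1 1 0 1 (legendreCoeff-rec-zero n))))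
coeff-shiftedLegendre (suc (suc n)) (suc j) = trans (coeff-shiftedLegendre-rec n (suc j)) (sym (
  bonnet-step (sgn n) (sgn j) (inv (suc (suc n))) (ℕtoℚ (suc (suc n))) (ℕtoℚ (suc n)) (ℕtoℚ (2 ℕ.* n ℕ.+ 3))
    (ℕtoℚ l₂) (ℕtoℚ l₁) (ℕtoℚ l₁′) (ℕtoℚ l₀)
    (coeff-shiftedLegendre (suc n) (suc j)) (coeff-shiftedLegendre (suc n) j) (coeff-shiftedLegendre n (suc j))
    (inv*ℕtoℚ≡1 (suc n)) (ℕtoℚ-recurrence n l₂ l₁ l₁′ l₀ (legendreCoeff-rec-suc n j))))
  where
  l₂ = legendreCoeff (suc (suc n)) (suc j)
  l₁ = legendreCoeff (suc n) (suc j)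
  l₁′ = legendreCoeff (suc n) j
  l₀ = legendreCoeff n (suc j)

coeff-sgn·shiftedLegendre-scaled : ∀ m k {x} → x ≡ suc m ℕ.* legendreCoeff (suc m) k →
  sgn k * (inv (suc m) * ℕtoℚ x) ≡ coeff (sgn (suc m) · shiftedLegendre (suc m)) k
coeff-sgn·shiftedLegendre-scaled m k refl = begin
  sgn k * (inv l * ℕtoℚ (l ℕ.* L))             ≡⟨ cong (λ y → sgn k * (inv l * y)) (ℕtoℚ-* l L) ⟩
  sgn k * (inv l * (ℕtoℚ l * ℕtoℚ L))          ≡⟨ cong (sgn k *_) (inv-cancelˡ m (ℕtoℚ L)) ⟩
  sgn k * ℕtoℚ L                               ≡⟨ *-identityˡ _ ⟨
  1ℚ * (sgn k * ℕtoℚ L)                        ≡⟨ cong (_* (sgn k * ℕtoℚ L)) (sgn*sgn≡1 l) ⟨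
  sgn l * sgn l * (sgn k * ℕtoℚ L)             ≡⟨ *-assoc (sgn l) (sgn l) _ ⟩
  sgn l * (sgn l * (sgn k * ℕtoℚ L))           ≡⟨ cong (sgn l *_) (coeff-shiftedLegendre l k) ⟨
  sgn l * coeff (shiftedLegendre l) k          ≡⟨ coeff-· (sgn l) (shiftedLegendre l) k ⟨
  coeff (sgn l · shiftedLegendre l) k          ∎
  where
  open ≡-Reasoning
  l = suc m
  L = legendreCoeff l k

coeff-map-applyUpTo : ∀ (f : ℕ → ℚ) g n → (∀ k → n ℕ.≤ k → f (g k) ≡ 0ℚ) → ∀ k → coeff (map f (applyUpTo g n)) k ≡ f (g k)
coeff-map-applyUpTo f g zero    f∘g≡0 k       = sym (f∘g≡0 k z≤n)
coeff-map-applyUpTo f g (suc n) f∘g≡0 zero    = refl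
coeff-map-applyUpTo f g (suc n) f∘g≡0 (suc k) = coeff-map-applyUpTo f (g ∘ suc) n (λ k n≤k → f∘g≡0 (suc k) (s≤s n≤k)) k

coeff-NA : ∀ l k → coeff (NA l) k ≡ sgn k * (inv l * ℕtoℚ ((l C k) ℕ.* ((l ℕ.+ k) C suc k)))
coeff-NA l = coeff-map-applyUpTo _ (λ k → k) (suc l) λ k l<k →
  trans (cong (λ x → sgn k * (inv l * ℕtoℚ (x ℕ.* ((l ℕ.+ k) C suc k)))) (k>n⇒nCk≡0 l<k)) (x*[y*0]≡0 (sgn k) (inv l))

coeff-NB : ∀ l k → coeff (NB l) k ≡ sgn k * ℕtoℚ ((l C k) ℕ.* ((l ℕ.+ k ℕ.∸ 1) C k))
coeff-NB l = coeff-map-applyUpTo _ (λ k → k) (suc l) λ k l<k →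
  trans (cong (λ x → sgn k * ℕtoℚ (x ℕ.* ((l ℕ.+ k ℕ.∸ 1) C k))) (k>n⇒nCk≡0 l<k)) (*-zeroʳ (sgn k))

NA+tNA′≈sgn·shiftedLegendre : ∀ m → NA (suc m) ⊕ T ⊗ deriv (NA (suc m)) ≈P sgn (suc m) · shiftedLegendre (suc m)
NA+tNA′≈sgn·shiftedLegendre m k = begin
  coeff (NA l ⊕ T ⊗ deriv (NA l)) k                   ≡⟨ coeff-⊕-T⊗deriv (NA l) k ⟩
  ℕtoℚ (suc k) * coeff (NA l) k                       ≡⟨ cong (ℕtoℚ (suc k) *_) (coeff-NA l k) ⟩
  ℕtoℚ (suc k) * (sgn k * (inv l * ℕtoℚ x))           ≡⟨ x∙yz≈y∙xz (ℕtoℚ (suc k)) (sgn k) _ ⟩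
  sgn k * (ℕtoℚ (suc k) * (inv l * ℕtoℚ x))           ≡⟨ cong (sgn k *_) (x∙yz≈y∙xz (ℕtoℚ (suc k)) (inv l) (ℕtoℚ x)) ⟩
  sgn k * (inv l * (ℕtoℚ (suc k) * ℕtoℚ x))           ≡⟨ cong (λ y → sgn k * (inv l * y)) (ℕtoℚ-* (suc k) x) ⟨
  sgn k * (inv l * ℕtoℚ (suc k ℕ.* x))                ≡⟨ coeff-sgn·shiftedLegendre-scaled m k ([k+1]*lCk*[l+k]C[k+1]≡l*legendreCoeff l k) ⟩
  coeff (sgn l · shiftedLegendre l) k                 ∎
  where
  open ≡-Reasoning
  l = suc m
  x = (l C k) ℕ.* ((l ℕ.+ k) C suc k)

NB+tNB′/l≈sgn·shiftedLegendre : ∀ m → NB (suc m) ⊕ inv (suc m) · (T ⊗ deriv (NB (suc m))) ≈P sgn (suc m) · shiftedLegendre (suc m)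
NB+tNB′/l≈sgn·shiftedLegendre m k = begin
  coeff (NB l ⊕ inv l · (T ⊗ deriv (NB l))) k
    ≡⟨ trans (coeff-⊕ (NB l) (inv l · (T ⊗ deriv (NB l))) k) (cong (c +_) (trans (coeff-· (inv l) (T ⊗ deriv (NB l)) k) (cong (inv l *_) (coeff-T⊗deriv (NB l) k)))) ⟩
  c + inv l * (ℕtoℚ k * c)                            ≡⟨ cong (_+ inv l * (ℕtoℚ k * c)) (inv-cancelˡ m c) ⟨
  inv l * (ℕtoℚ l * c) + inv l * (ℕtoℚ k * c)         ≡⟨ *-distribˡ-+ (inv l) _ _ ⟨
  inv l * (ℕtoℚ l * c + ℕtoℚ k * c)                   ≡⟨ cong (inv l *_) (*-distribʳ-+ c (ℕtoℚ l) (ℕtoℚ k)) ⟨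
  inv l * ((ℕtoℚ l + ℕtoℚ k) * c)                     ≡⟨ cong (λ y → inv l * (y * c)) (ℕtoℚ-+ l k) ⟨
  inv l * (ℕtoℚ (l ℕ.+ k) * c)                        ≡⟨ cong (λ y → inv l * (ℕtoℚ (l ℕ.+ k) * y)) (coeff-NB l k) ⟩
  inv l * (ℕtoℚ (l ℕ.+ k) * (sgn k * ℕtoℚ x))         ≡⟨ cong (inv l *_) (x∙yz≈y∙xz (ℕtoℚ (l ℕ.+ k)) (sgn k) (ℕtoℚ x)) ⟩
  inv l * (sgn k * (ℕtoℚ (l ℕ.+ k) * ℕtoℚ x))         ≡⟨ x∙yz≈y∙xz (inv l) (sgn k) _ ⟩
  sgn k * (inv l * (ℕtoℚ (l ℕ.+ k) * ℕtoℚ x))         ≡⟨ cong (λ y → sgn k * (inv l * y)) (ℕtoℚ-* (l ℕ.+ k) x) ⟨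
  sgn k * (inv l * ℕtoℚ ((l ℕ.+ k) ℕ.* x))            ≡⟨ coeff-sgn·shiftedLegendre-scaled m k ([l+k]*lCk*[l+k-1]Ck≡l*legendreCoeff m k) ⟩
  coeff (sgn l · shiftedLegendre l) k                 ∎
  where
  open ≡-Reasoning
  l = suc m
  c = coeff (NB l) k
  x = (l C k) ℕ.* ((m ℕ.+ k) C k)

proposition6p4 :
    (∀ (l : ℕ) → 1 ≤ l →
        (deriv (T ⊗ NA l) ≈P (NA l ⊕ (T ⊗ deriv (NA l))))
      × ((NA l ⊕ (T ⊗ deriv (NA l))) ≈P (sgn l · shiftedLegendre l)))
    × (∀ (l : ℕ) → 2 ≤ l →
        (NB l ⊕ (inv l · (T ⊗ deriv (NB l)))) ≈P (sgn l · shiftedLegendre l))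
proposition6p4 =
    (λ { (suc m) _ → ≋⇒≈P (deriv-T⊗ (NA (suc m))) , NA+tNA′≈sgn·shiftedLegendre m })
  , (λ { (suc m) _ → NB+tNB′/l≈sgn·shiftedLegendre m })
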